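{- Let $D=(F,R,>)$ be a defeasible theory. Then $\mathcal{T}_D$ is monotonic (with respect to pointwise inclusion) and the Kleene sequence $(\mathcal{T}_D\uparrow n)_{n<\omega}$ from $\bot$ is increasing. Consequently the limit $\bigcup_{n<\omega}\mathcal{T}_D\uparrow n$ of all finite elements of the sequence exists and $\mathcal{T}_D$ has a least fixpoint $L$. When $D$ is a finite propositional defeasible theory, the limit of the finite elements equals $L$.
   Context: Literals are atoms $p$ or negated atoms $\neg p$; for a literal $q$, $\sim q$ is its complement. A defeasible theory $D=(F,R,>)$ consists of a set $F$ of literals (facts), a set $R$ of rules, and a binary relation $>$ on $R$ whose transitive closure is irreflexive; rules with variables stand for the set of their ground instances. Each (ground) rule $r$ has a unique label, an antecedent $A(r)$ (finite set of literals), a head $C(r)$ (a literal) and a kind: strict, defeasible or defeater. $R_s$: strict rules; $R_{sd}$: strict or defeasible rules; $R[q]$, $R_s[q]$, $R_{sd}[q]$: those with head $q$. An extension is a 4-tuple $(+\Delta,-\Delta,+\partial,-\partial)$ of sets of literals; extensions form a complete lattice under pointwise inclusion, with least element $\bot=(\emptyset,\emptyset,\emptyset,\emptyset)$ and pointwise union as join. The operator $\mathcal{T}_D(+\Delta,-\Delta,+\partial,-\partial)=(+\Delta',-\Delta',+\partial',-\partial')$ is: $+\Delta'=F\cup\{q\mid\exists r\in R_s[q]:A(r)\subseteq+\Delta\}$; $-\Delta'=-\Delta\cup(\{q\mid\forall r\in R_s[q]:A(r)\cap-\Delta\neq\emptyset\}\setminus F)$; $+\partial'=+\Delta\cup\{q\mid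 \exists r\in R_{sd}[q]:A(r)\subseteq+\partial$, $\sim q\in-\Delta$, and $\forall s\in R[\sim q]$ either $A(s)\cap-\partial\neq\emptyset$ or $\exists t\in R_{sd}[q]$ with $A(t)\subseteq+\partial$ and $t>s\}$; $-\partial'=\{q\in-\Delta\mid (\forall r\in R_{sd}[q]:A(r)\cap-\partial\neq\emptyset)$, or $\sim q\in+\Delta$, or $\exists s\in R[\sim q]$ with $A(s)\subseteq+\partial$ and $\forall t\in R_{sd}[q]$ either $A(t)\cap-\partial\neq\emptyset$ or $t\not>s\}$. The Kleene sequence is $\mathcal{T}_D\uparrow 0=\bot$, $\mathcal{T}_D\uparrow(n+1)=\mathcal{T}_D(\mathcal{T}_D\uparrow n)$. -}

module Defs where

open import Data.Nat using (ℕ; zero; suc)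
open import Data.Product using (Σ; ∃; _×_; _,_)
open import Data.Sum using (_⊎_)
open import Data.Empty using (⊥)
open import Data.List using (List)
open import Data.List.Relation.Unary.All using (All)
open import Data.List.Relation.Unary.Any using (Any)
open import Data.List.Membership.Propositional using (_∈_)
open import Relation.Nullary using (¬_)
open import Relation.Binary.PropositionalEquality using (_≡_)
open import Relation.Binary.Construct.Closure.Transitive using (TransClosure)

data Lit (Atom : Set) : Set where
  pos : Atom → Lit Atom
  neg : Atom → Lit Atom

∼_ : {Atom : Set} → Lit Atom → Lit Atom
∼ pos a = neg a
∼ neg a = pos a

data Kind : Set where
  strict defeasible defeater : Kind

IsSD : Kind → Set
IsSD k = (k ≡ strict) ⊎ (k ≡ defeasible)

-- The elements of `Rule` are
-- the (unique) labels of the ground rules (ground instances of rules with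
-- variables); each has a finite antecedent, a head and a kind.
record Theory (Atom : Set) : Set₁ where
  field
    Fact : Lit Atom → Set
    Rule : Set
    ante : Rule → List (Lit Atom)
    head : Rule → Lit Atom
    kind : Rule → Kind
    _≻_  : Rule → Rule → Set
    acyclic : ∀ r → ¬ TransClosure _≻_ r r

record Ext (Atom : Set) : Set₁ where
  constructor ext
  field
    +Δ -Δ +∂ -∂ : Lit Atom → Set
open Ext public

_⊑_ : {Atom : Set} → Ext Atom → Ext Atom → Set
X ⊑ Y = (∀ q → +Δ X q → +Δ Y q) × (∀ q → -Δ X q → -Δ Y q)
      × (∀ q → +∂ X q → +∂ Y q) × (∀ q → -∂ X q → -∂ Y q)

_≐_ : {Atom : Set} → Ext Atom → Ext Atom → Set
X ≐ Y = (X ⊑ Y) × (Y ⊑ X)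

⊥ext : {Atom : Set} → Ext Atom
⊥ext = ext (λ _ → ⊥) (λ _ → ⊥) (λ _ → ⊥) (λ _ → ⊥)

_↑_ : {Atom : Set} → (Ext Atom → Ext Atom) → ℕ → Ext Atom
f ↑ zero = ⊥ext
f ↑ suc n = f (f ↑ n)

module _ {Atom : Set} (D : Theory Atom) where
  open Theory D

  InRs : Rule → Lit Atom → Set
  InRs r q = (kind r ≡ strict) × (head r ≡ q)

  InRsd : Rule → Lit Atom → Set
  InRsd r q = IsSD (kind r) × (head r ≡ q)

  InR : Rule → Lit Atom → Set
  InR r q = head r ≡ q

  T : Ext Atom → Ext Atom
  T X = ext +Δ' -Δ' +∂' -∂'
    where
    +Δ' : Lit Atom → Set
    +Δ' q = Fact q ⊎ Σ Rule (λ r → InRs r q × All (+Δ X) (ante r))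
    -Δ' : Lit Atom → Set
    -Δ' q = -Δ X q
          ⊎ ((∀ r → InRs r q → Any (-Δ X) (ante r)) × ¬ Fact q)
    +∂' : Lit Atom → Set
    +∂' q = +Δ X q
          ⊎ (Σ Rule (λ r → InRsd r q × All (+∂ X) (ante r))
             × -Δ X (∼ q)
             × (∀ s → InR s (∼ q) →
                  Any (-∂ X) (ante s)
                  ⊎ Σ Rule (λ t → InRsd t q × All (+∂ X) (ante t) × (t ≻ s))))
    -∂' : Lit Atom → Set
    -∂' q = -Δ X q
          × ((∀ r → InRsd r q → Any (-∂ X) (ante r))
             ⊎ +Δ X (∼ q)
             ⊎ Σ Rule (λ s → InR s (∼ q) × All (+∂ X) (ante s)
                 × (∀ t → InRsd t q → Any (-∂ X) (ante t) ⊎ ¬ (t ≻ s))))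

  limit : Ext Atom
  limit = ext (λ q → Σ ℕ λ n → +Δ (T ↑ n) q) (λ q → Σ ℕ λ n → -Δ (T ↑ n) q)
              (λ q → Σ ℕ λ n → +∂ (T ↑ n) q) (λ q → Σ ℕ λ n → -∂ (T ↑ n) q)

  IsLeastFixpoint : Ext Atom → Set₁
  IsLeastFixpoint L = (T L ≐ L) × (∀ X → T X ≐ X → L ⊑ X)

  -- D is a finite propositional theory: finitely many (ground) rules and
  -- finitely many facts (antecedents are always finite lists).
  Finite : Set
  Finite = (Σ (List Rule) λ rs → ∀ r → r ∈ rs)
         × (Σ (List (Lit Atom)) λ fs → ∀ q → (Fact q → q ∈ fs) × (q ∈ fs → Fact q))

-- Kleene iteration from ⊥ is monotone, so the limit is below every prefixpoint; in general the
-- least fixpoint is the inductive family μT generated by T_D.  For a finite theory the limit is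
-- itself a fixpoint.  Constructively this needs a uniform bound on the stages, since membership
-- in an extension is undecidable.  Fix a literal q.  On the literals relevant to q (q, the
-- antecedent literals, and their complements) T_D is a finite positive system in m unknowns
-- whose only hypotheses are the k conditions "rule r has head ℓ", which cannot be decided.  A
-- derivation is compressed by re-proving any goal that recurs on a branch from its later
-- derivation: without hypotheses m stages suffice, and each new head hypothesis met restarts
-- the count, so every derivation fits into (k + 1)·m stages.

module Submission where

open import Defs
open import Data.Bool using (Bool; true; false; not)
open import Data.Bool.Properties using () renaming (_≟_ to _≟ᵇ_)
open import Data.Empty using (⊥; ⊥-elim)
open import Data.Fin using (Fin; zero; suc) renaming (_≟_ to _≟ᶠ_)
open import Data.Fin.Properties using (∀-cons)
open import Data.List
  using (List; []; _∷_; _++_; length; lookup; map; concatMap; allFin; cartesianProduct)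
open import Data.List.Membership.Propositional using (_∈_; _∉_; lose)
open import Data.List.Membership.Propositional.Properties
  using (∈-∃++; ∈-lookup; ∈-allFin; ∈-map⁺; ∈-concatMap⁺; ∈-cartesianProduct⁺)
open import Data.List.Membership.DecPropositional as DecMembership using ()
open import Data.List.Relation.Binary.Permutation.Propositional.Properties
  using (shift; ↭-length; ∈-resp-↭)
open import Data.List.Relation.Unary.All as All using (All; []; _∷_)
open import Data.List.Relation.Unary.All.Properties using (¬Any⇒All¬)
open import Data.List.Relation.Unary.Any as Any using (Any; here; there)
open import Data.List.Relation.Unary.Any.Properties using (lookup-index)
open import Data.List.Relation.Unary.AllPairs using ([]; _∷_)
open import Data.List.Relation.Unary.Unique.Propositional using (Unique)
open import Data.Maybe using (Maybe; nothing; just)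
import Data.Maybe.Properties as Maybe
open import Data.Nat using (ℕ; zero; suc; _+_; _*_; _≤_; _<_; z≤n; s≤s)
open import Data.Nat.Properties using (+-suc; +-identityʳ; m≤n+m; <-irrefl; module ≤-Reasoning)
open import Data.Product using (Σ; ∃; _×_; _,_; uncurry)
import Data.Product.Properties as Product
open import Data.Sum using (_⊎_; inj₁; inj₂; [_,_])
import Data.Sum as Sum
open import Function using (id; _∘_; case_of_)
open import Relation.Binary.Definitions using (DecidableEquality)
open import Relation.Binary.PropositionalEquality using (_≡_; _≢_; refl; sym; trans; subst)
open import Relation.Nullary using (¬_; Dec; yes; no)

module _ {A : Set} where

  unique-length≤ : ∀ {xs ys : List A} → Unique xs → All (_∈ ys) xs → length xs ≤ length ys
  unique-length≤ [] [] = z≤n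
  unique-length≤ {x ∷ xs} (x∉xs ∷ u) (x∈ys ∷ xs⊆ys)
    with pre , post , refl ← ∈-∃++ x∈ys = begin
    suc (length xs)             ≤⟨ s≤s (unique-length≤ u (All.zipWith drop-x (x∉xs , xs⊆ys))) ⟩
    suc (length (pre ++ post))  ≡⟨ sym (↭-length (shift x pre post)) ⟩
    length (pre ++ x ∷ post)    ∎
    where
    open ≤-Reasoning
    drop-x : ∀ {z} → x ≢ z × z ∈ pre ++ x ∷ post → z ∈ pre ++ post
    drop-x (x≢z , z∈) with ∈-resp-↭ (shift x pre post) z∈
    ... | here z≡x = ⊥-elim (x≢z (sym z≡x))
    ... | there z∈pre++post = z∈pre++post

  unique-length< : ∀ {x : A} {xs ys} → (∀ y → y ∈ ys) → Unique xs → x ∉ xs → length xs < length ys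
  unique-length< {xs = xs} ∈ys u x∉xs =
    unique-length≤ (¬Any⇒All¬ xs x∉xs ∷ u) (All.tabulate λ {y} _ → ∈ys y)

module _ {A B C : Set} where

  ⊎-both : A ⊎ C → B ⊎ C → (A × B) ⊎ C
  ⊎-both (inj₁ a) (inj₁ b) = inj₁ (a , b)
  ⊎-both (inj₂ c) _ = inj₂ c
  ⊎-both (inj₁ _) (inj₂ c) = inj₂ c

⊎-all : ∀ {n} {A : Fin n → Set} {C : Set} → (∀ i → A i ⊎ C) → (∀ i → A i) ⊎ C
⊎-all {zero} f = inj₁ λ ()
⊎-all {suc n} f = Sum.map₁ (uncurry ∀-cons) (⊎-both (f zero) (⊎-all (λ i → f (suc i))))

module _ {A : Set} {P : A → Set} where

  All⇒lookup : ∀ {xs} → All P xs → ∀ i → P (lookup xs i)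
  All⇒lookup (px ∷ pxs) zero = px
  All⇒lookup (px ∷ pxs) (suc i) = All⇒lookup pxs i

  lookup⇒All : ∀ {xs} → (∀ i → P (lookup xs i)) → All P xs
  lookup⇒All {[]} f = []
  lookup⇒All {x ∷ xs} f = f zero ∷ lookup⇒All (f ∘ suc)

  Any⇒lookup : ∀ {xs} → Any P xs → ∃ λ i → P (lookup xs i)
  Any⇒lookup p = Any.index p , lookup-index p

  lookup⇒Any : ∀ {xs} → (∃ λ i → P (lookup xs i)) → Any P xs
  lookup⇒Any (i , p) = lose (∈-lookup i) p

module GuardedFormulas (Pos Guard : Set) (Holds : Guard → Set) where

  infixr 6 _∧_
  infixr 5 _∨_
  infixr 4 _⇒_ _⇒?_

  data Formula : Set₁ where
    const   : Set → Formula
    var     : Pos → Formula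
    _∧_ _∨_ : Formula → Formula → Formula
    ⋀ ⋁     : {n : ℕ} → (Fin n → Formula) → Formula
    _⇒_     : Guard → Formula → Formula
    _⇒?_    : {A : Set} → Dec A → Formula → Formula

  ⟦_⟧ : Formula → (Pos → Set) → Set
  ⟦ const A ⟧ X = A
  ⟦ var p ⟧ X = X p
  ⟦ φ ∧ ψ ⟧ X = ⟦ φ ⟧ X × ⟦ ψ ⟧ X
  ⟦ φ ∨ ψ ⟧ X = ⟦ φ ⟧ X ⊎ ⟦ ψ ⟧ X
  ⟦ ⋀ φ ⟧ X = ∀ i → ⟦ φ i ⟧ X
  ⟦ ⋁ φ ⟧ X = ∃ λ i → ⟦ φ i ⟧ X
  ⟦ α ⇒ φ ⟧ X = Holds α → ⟦ φ ⟧ X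
  ⟦ _⇒?_ {A} _ φ ⟧ X = A → ⟦ φ ⟧ X

  ⟦⟧-mono : ∀ φ {X Y : Pos → Set} → (∀ p → X p → Y p) → ⟦ φ ⟧ X → ⟦ φ ⟧ Y
  ⟦⟧-mono (const A) X⊆Y x = x
  ⟦⟧-mono (var p) X⊆Y x = X⊆Y p x
  ⟦⟧-mono (φ ∧ ψ) X⊆Y (x , y) = ⟦⟧-mono φ X⊆Y x , ⟦⟧-mono ψ X⊆Y y
  ⟦⟧-mono (φ ∨ ψ) X⊆Y (inj₁ x) = inj₁ (⟦⟧-mono φ X⊆Y x)
  ⟦⟧-mono (φ ∨ ψ) X⊆Y (inj₂ y) = inj₂ (⟦⟧-mono ψ X⊆Y y)
  ⟦⟧-mono (⋀ φ) X⊆Y x = λ i → ⟦⟧-mono (φ i) X⊆Y (x i)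
  ⟦⟧-mono (⋁ φ) X⊆Y (i , x) = i , ⟦⟧-mono (φ i) X⊆Y x
  ⟦⟧-mono (α ⇒ φ) X⊆Y x = λ h → ⟦⟧-mono φ X⊆Y (x h)
  ⟦⟧-mono (d ⇒? φ) X⊆Y x = λ a → ⟦⟧-mono φ X⊆Y (x a)

  iterate : (Pos → Formula) → ℕ → Pos → Set
  iterate Φ zero p = ⊥
  iterate Φ (suc n) p = ⟦ Φ p ⟧ (iterate Φ n)

  iterate-mono : ∀ Φ {m n} → m ≤ n → ∀ p → iterate Φ m p → iterate Φ n p
  iterate-mono Φ {suc m} {suc n} (s≤s m≤n) p x = ⟦⟧-mono (Φ p) (iterate-mono Φ m≤n) x

module Stabilisation
  {Pos : Set} (_≟ₚ_ : DecidableEquality Pos)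
  (positions : List Pos) (∈-positions : ∀ p → p ∈ positions)
  {Guard : Set} (_≟ᵍ_ : DecidableEquality Guard)
  (guards : List Guard) (∈-guards : ∀ α → α ∈ guards)
  (Holds : Guard → Set) (Φ : Pos → GuardedFormulas.Formula Pos Guard Holds) where

  open GuardedFormulas Pos Guard Holds
  open DecMembership _≟ₚ_ using () renaming (_∈?_ to _∈ₚ?_)
  open DecMembership _≟ᵍ_ using () renaming (_∈?_ to _∈ᵍ?_)

  m k : ℕ
  m = length positions
  k = length guards

  X : ℕ → Pos → Set
  X = iterate Φ

  -- A stack S with budget e lists pending goals: its top position is wanted at stage
  -- suc e + g * m, the next one at stage suc (suc e) + g * m, and so on.
  data Resolved (g : ℕ) : ℕ → List Pos → Set where
    here  : ∀ {e v S} → X (suc e + g * m) v → Resolved g e (v ∷ S)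
    there : ∀ {e v S} → Resolved g (suc e) S → Resolved g e (v ∷ S)

  module Compress (g : ℕ) {Γ : List Guard} (Γ-holds : All Holds Γ)
                  (beyond : ∀ {α} → α ∉ Γ → Holds α → ∀ φ n → ⟦ φ ⟧ (X n) → ⟦ φ ⟧ (X (g * m)))
                  where

    mutual
      compress : ∀ {S} → Unique S → ∀ e → e + length S ≡ m →
                 ∀ n φ → ⟦ φ ⟧ (X n) → ⟦ φ ⟧ (X (e + g * m)) ⊎ Resolved g e S
      compress uS e eS n (const A) x = inj₁ x
      compress uS e eS n (var p) x = compress-var uS e eS n p x
      compress uS e eS n (φ ∧ ψ) (x , y) =
        ⊎-both (compress uS e eS n φ x) (compress uS e eS n ψ y)
      compress uS e eS n (φ ∨ ψ) (inj₁ x) = Sum.map₁ inj₁ (compress uS e eS n φ x)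
      compress uS e eS n (φ ∨ ψ) (inj₂ y) = Sum.map₁ inj₂ (compress uS e eS n ψ y)
      compress uS e eS n (⋀ φ) x = ⊎-all λ i → compress uS e eS n (φ i) (x i)
      compress uS e eS n (⋁ φ) (i , x) = Sum.map₁ (i ,_) (compress uS e eS n (φ i) x)
      compress uS e eS n (α ⇒ φ) x with α ∈ᵍ? Γ
      ... | yes α∈Γ = Sum.map₁ (λ y _ → y) (compress uS e eS n φ (x (All.lookup Γ-holds α∈Γ)))
      ... | no α∉Γ =
        inj₁ λ h → ⟦⟧-mono φ (iterate-mono Φ (m≤n+m (g * m) e)) (beyond α∉Γ h φ n (x h))
      compress uS e eS n (yes a ⇒? φ) x = Sum.map₁ (λ y _ → y) (compress uS e eS n φ (x a))
      compress uS e eS n (no ¬a ⇒? φ) x = inj₁ λ a → ⊥-elim (¬a a)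

      compress-var : ∀ {S} → Unique S → ∀ e → e + length S ≡ m →
                     ∀ n q → X n q → X (e + g * m) q ⊎ Resolved g e S
      compress-var {S} uS e eS (suc n) q x with q ∈ₚ? S
      ... | yes q∈S = inj₂ (reroot uS e eS n q∈S x)
      ... | no q∉S = push uS e eS n q∉S x

      reroot : ∀ {S} → Unique S → ∀ e → e + length S ≡ m →
               ∀ n {q} → q ∈ S → ⟦ Φ q ⟧ (X n) → Resolved g e S
      reroot uS e eS n {q} (here refl) x = [ here , id ] (compress uS e eS n (Φ q) x)
      reroot (_ ∷ uS) e eS n (there q∈S) x =
        there (reroot uS (suc e) (trans (sym (+-suc e _)) eS) n q∈S x)

      push : ∀ {S} → Unique S → ∀ e → e + length S ≡ m →
             ∀ n {q} → q ∉ S → ⟦ Φ q ⟧ (X n) → X (e + g * m) q ⊎ Resolved g e S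
      push uS zero eS n q∉S x = ⊥-elim (<-irrefl eS (unique-length< ∈-positions uS q∉S))
      push {S} uS (suc e) eS n {q} q∉S x
        with compress (¬Any⇒All¬ S q∉S ∷ uS) e (trans (+-suc e _) eS) n (Φ q) x
      ... | inj₁ y = inj₁ y
      ... | inj₂ (here y) = inj₁ y
      ... | inj₂ (there r) = inj₂ r

    compress-fresh : ∀ φ n → ⟦ φ ⟧ (X n) → ⟦ φ ⟧ (X (m + g * m))
    compress-fresh φ n x = [ id , (λ ()) ] (compress [] m (+-identityʳ m) n φ x)

  -- A guard cannot be decided, so under a new one the compression restarts with an empty
  -- stack, one level further down.
  stabilise-under : ∀ g {Γ} → Unique Γ → g + length Γ ≡ k → All Holds Γ →
                    ∀ φ n → ⟦ φ ⟧ (X n) → ⟦ φ ⟧ (X (m + g * m))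
  stabilise-under zero uΓ eΓ Γ-holds = Compress.compress-fresh zero Γ-holds λ α∉Γ →
    ⊥-elim (<-irrefl eΓ (unique-length< ∈-guards uΓ α∉Γ))
  stabilise-under (suc g) {Γ} uΓ eΓ Γ-holds =
    Compress.compress-fresh (suc g) Γ-holds λ α∉Γ h →
      stabilise-under g (¬Any⇒All¬ Γ α∉Γ ∷ uΓ) (trans (+-suc g _) eΓ) (h ∷ Γ-holds)

  N : ℕ
  N = m + k * m

  stabilises : ∀ n p → X n p → X N p
  stabilises n p = stabilise-under k [] (+-identityʳ k) [] (var p) n

data Component : Set where
  +Δᶜ -Δᶜ +∂ᶜ -∂ᶜ : Component

_≟ᶜ_ : DecidableEquality Component
+Δᶜ ≟ᶜ +Δᶜ = yes refl
+Δᶜ ≟ᶜ -Δᶜ = no λ ()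
+Δᶜ ≟ᶜ +∂ᶜ = no λ ()
+Δᶜ ≟ᶜ -∂ᶜ = no λ ()
-Δᶜ ≟ᶜ +Δᶜ = no λ ()
-Δᶜ ≟ᶜ -Δᶜ = yes refl
-Δᶜ ≟ᶜ +∂ᶜ = no λ ()
-Δᶜ ≟ᶜ -∂ᶜ = no λ ()
+∂ᶜ ≟ᶜ +Δᶜ = no λ ()
+∂ᶜ ≟ᶜ -Δᶜ = no λ ()
+∂ᶜ ≟ᶜ +∂ᶜ = yes refl
+∂ᶜ ≟ᶜ -∂ᶜ = no λ ()
-∂ᶜ ≟ᶜ +Δᶜ = no λ ()
-∂ᶜ ≟ᶜ -Δᶜ = no λ ()
-∂ᶜ ≟ᶜ +∂ᶜ = no λ ()
-∂ᶜ ≟ᶜ -∂ᶜ = yes refl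

components : List Component
components = +Δᶜ ∷ -Δᶜ ∷ +∂ᶜ ∷ -∂ᶜ ∷ []

∈-components : ∀ c → c ∈ components
∈-components +Δᶜ = here refl
∈-components -Δᶜ = there (here refl)
∈-components +∂ᶜ = there (there (here refl))
∈-components -∂ᶜ = there (there (there (here refl)))

module _ {Atom : Set} where

  component : Component → Ext Atom → Lit Atom → Set
  component +Δᶜ = +Δ
  component -Δᶜ = -Δ
  component +∂ᶜ = +∂
  component -∂ᶜ = -∂

  ⊑-intro : {X Y : Ext Atom} → (∀ c ℓ → component c X ℓ → component c Y ℓ) → X ⊑ Y
  ⊑-intro f = f +Δᶜ , f -Δᶜ , f +∂ᶜ , f -∂ᶜ

  ⊑-elim : {X Y : Ext Atom} → X ⊑ Y → ∀ c ℓ → component c X ℓ → component c Y ℓ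
  ⊑-elim (X⊑Y , _) +Δᶜ = X⊑Y
  ⊑-elim (_ , X⊑Y , _) -Δᶜ = X⊑Y
  ⊑-elim (_ , _ , X⊑Y , _) +∂ᶜ = X⊑Y
  ⊑-elim (_ , _ , _ , X⊑Y) -∂ᶜ = X⊑Y

  ⊑-trans : {X Y Z : Ext Atom} → X ⊑ Y → Y ⊑ Z → X ⊑ Z
  ⊑-trans X⊑Y Y⊑Z = ⊑-intro λ c ℓ x → ⊑-elim Y⊑Z c ℓ (⊑-elim X⊑Y c ℓ x)

  ⊥ext-empty : ∀ c {ℓ} → ¬ component c ⊥ext ℓ
  ⊥ext-empty +Δᶜ ()
  ⊥ext-empty -Δᶜ ()
  ⊥ext-empty +∂ᶜ ()
  ⊥ext-empty -∂ᶜ ()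

  ⊥ext-least : (X : Ext Atom) → ⊥ext ⊑ X
  ⊥ext-least X = ⊑-intro λ c ℓ x → ⊥-elim (⊥ext-empty c x)

module _ {Atom : Set} (D : Theory Atom) where
  open Theory D

  T-mono : ∀ X Y → X ⊑ Y → T D X ⊑ T D Y
  T-mono X Y (+Δ⊆ , -Δ⊆ , +∂⊆ , -∂⊆) = +Δ′⊆ , -Δ′⊆ , +∂′⊆ , -∂′⊆
    where
    +Δ′⊆ : ∀ q → +Δ (T D X) q → +Δ (T D Y) q
    +Δ′⊆ q (inj₁ f) = inj₁ f
    +Δ′⊆ q (inj₂ (r , h , as)) = inj₂ (r , h , All.map (+Δ⊆ _) as)
    -Δ′⊆ : ∀ q → -Δ (T D X) q → -Δ (T D Y) q
    -Δ′⊆ q (inj₁ x) = inj₁ (-Δ⊆ q x)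
    -Δ′⊆ q (inj₂ (f , nf)) = inj₂ ((λ r h → Any.map (-Δ⊆ _) (f r h)) , nf)
    +∂′⊆ : ∀ q → +∂ (T D X) q → +∂ (T D Y) q
    +∂′⊆ q (inj₁ x) = inj₁ (+Δ⊆ q x)
    +∂′⊆ q (inj₂ ((r , h , as) , x , f)) =
      inj₂ ((r , h , All.map (+∂⊆ _) as) , -Δ⊆ _ x , λ s h →
        Sum.map (Any.map (-∂⊆ _)) (λ (t , h′ , as′ , t≻s) → t , h′ , All.map (+∂⊆ _) as′ , t≻s)
                (f s h))
    -∂′⊆ : ∀ q → -∂ (T D X) q → -∂ (T D Y) q
    -∂′⊆ q (x , inj₁ f) = -Δ⊆ q x , inj₁ (λ r h → Any.map (-∂⊆ _) (f r h))
    -∂′⊆ q (x , inj₂ (inj₁ y)) = -Δ⊆ q x , inj₂ (inj₁ (+Δ⊆ _ y))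
    -∂′⊆ q (x , inj₂ (inj₂ (s , h , as , f))) =
      -Δ⊆ q x , inj₂ (inj₂ (s , h , All.map (+∂⊆ _) as , λ t h′ →
        Sum.map₁ (Any.map (-∂⊆ _)) (f t h′)))

  Kleene-increasing : ∀ n → (T D ↑ n) ⊑ (T D ↑ suc n)
  Kleene-increasing zero = ⊥ext-least _
  Kleene-increasing (suc n) = T-mono _ _ (Kleene-increasing n)

  Kleene⊑limit : ∀ n → (T D ↑ n) ⊑ limit D
  Kleene⊑limit n = (λ _ x → n , x) , (λ _ x → n , x) , (λ _ x → n , x) , (λ _ x → n , x)

  limit-stage : ∀ c {ℓ} → component c (limit D) ℓ → ∃ λ n → component c (T D ↑ n) ℓ
  limit-stage +Δᶜ x = x
  limit-stage -Δᶜ x = x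
  limit-stage +∂ᶜ x = x
  limit-stage -∂ᶜ x = x

  limit-least : ∀ Y → (∀ n → (T D ↑ n) ⊑ Y) → limit D ⊑ Y
  limit-least Y ↑⊑Y = ⊑-intro λ c ℓ x → let n , y = limit-stage c x in ⊑-elim (↑⊑Y n) c ℓ y

  Kleene⊑prefixpoint : ∀ {X} → T D X ⊑ X → ∀ n → (T D ↑ n) ⊑ X
  Kleene⊑prefixpoint TX⊑X zero = ⊥ext-least _
  Kleene⊑prefixpoint TX⊑X (suc n) = ⊑-trans (T-mono _ _ (Kleene⊑prefixpoint TX⊑X n)) TX⊑X

  limit⊑T-limit : limit D ⊑ T D (limit D)
  limit⊑T-limit = limit-least _ λ n → ⊑-trans (Kleene-increasing n) (T-mono _ _ (Kleene⊑limit n))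

  data μT : Component → Lit Atom → Set where
    fold : ∀ {c q} → component c (T D (ext (μT +Δᶜ) (μT -Δᶜ) (μT +∂ᶜ) (μT -∂ᶜ))) q → μT c q

  μT-ext : Ext Atom
  μT-ext = ext (μT +Δᶜ) (μT -Δᶜ) (μT +∂ᶜ) (μT -∂ᶜ)

  μT-fixpoint : T D μT-ext ≐ μT-ext
  μT-fixpoint =
    ((λ _ → fold) , (λ _ → fold) , (λ _ → fold) , (λ _ → fold)) ,
    ((λ { _ (fold x) → x }) , (λ { _ (fold x) → x }) , (λ { _ (fold x) → x }) , (λ { _ (fold x) → x }))

  -- The proof of T-mono again, with the recursion through All and Any spelled out so that the
  -- termination checker sees that it is structural.
  module _ {X : Ext Atom} (TX⊑X : T D X ⊑ X) where
    mutual
      μT⊆ : ∀ {c q} → μT c q → component c X q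
      μT⊆ {c} (fold x) = ⊑-elim TX⊑X c _ (T-μT⊆T c x)

      all⊆ : ∀ {c xs} → All (μT c) xs → All (component c X) xs
      all⊆ [] = []
      all⊆ (x ∷ xs) = μT⊆ x ∷ all⊆ xs

      any⊆ : ∀ {c xs} → Any (μT c) xs → Any (component c X) xs
      any⊆ (here x) = here (μT⊆ x)
      any⊆ (there x) = there (any⊆ x)

      T-μT⊆T : ∀ c {q} → component c (T D μT-ext) q → component c (T D X) q
      T-μT⊆T +Δᶜ (inj₁ f) = inj₁ f
      T-μT⊆T +Δᶜ (inj₂ (r , h , as)) = inj₂ (r , h , all⊆ as)
      T-μT⊆T -Δᶜ (inj₁ x) = inj₁ (μT⊆ x)
      T-μT⊆T -Δᶜ (inj₂ (f , nf)) = inj₂ ((λ r h → any⊆ (f r h)) , nf)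
      T-μT⊆T +∂ᶜ (inj₁ x) = inj₁ (μT⊆ x)
      T-μT⊆T +∂ᶜ (inj₂ ((r , h , as) , x , f)) =
        inj₂ ((r , h , all⊆ as) , μT⊆ x , λ s h → defeated⊆ (f s h))
      T-μT⊆T -∂ᶜ (x , inj₁ f) = μT⊆ x , inj₁ (λ r h → any⊆ (f r h))
      T-μT⊆T -∂ᶜ (x , inj₂ (inj₁ y)) = μT⊆ x , inj₂ (inj₁ (μT⊆ y))
      T-μT⊆T -∂ᶜ (x , inj₂ (inj₂ (s , h , as , f))) =
        μT⊆ x , inj₂ (inj₂ (s , h , all⊆ as , λ t h′ → not-superior⊆ (f t h′)))

      defeated⊆ : ∀ {q s} →
                  Any (μT -∂ᶜ) (ante s) ⊎ Σ Rule (λ t → InRsd D t q × All (μT +∂ᶜ) (ante t) × t ≻ s) →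
                  Any (-∂ X) (ante s) ⊎ Σ Rule (λ t → InRsd D t q × All (+∂ X) (ante t) × t ≻ s)
      defeated⊆ (inj₁ xs) = inj₁ (any⊆ xs)
      defeated⊆ (inj₂ (t , h , as , t≻s)) = inj₂ (t , h , all⊆ as , t≻s)

      not-superior⊆ : ∀ {xs} {P : Set} → Any (μT -∂ᶜ) xs ⊎ P → Any (-∂ X) xs ⊎ P
      not-superior⊆ (inj₁ xs) = inj₁ (any⊆ xs)
      not-superior⊆ (inj₂ p) = inj₂ p

  μT-least-fixpoint : IsLeastFixpoint D μT-ext
  μT-least-fixpoint = μT-fixpoint , λ X (TX⊑X , _) →
    (λ _ → μT⊆ TX⊑X) , (λ _ → μT⊆ TX⊑X) , (λ _ → μT⊆ TX⊑X) , (λ _ → μT⊆ TX⊑X)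

∼-involutive : ∀ {Atom : Set} (ℓ : Lit Atom) → ∼ (∼ ℓ) ≡ ℓ
∼-involutive (pos a) = refl
∼-involutive (neg a) = refl

∈-bools : ∀ b → b ∈ false ∷ true ∷ []
∈-bools false = here refl
∈-bools true = there (here refl)

strict? : ∀ k → Dec (k ≡ strict)
strict? strict = yes refl
strict? defeasible = no λ ()
strict? defeater = no λ ()

strict-or-defeasible? : ∀ k → Dec (IsSD k)
strict-or-defeasible? strict = yes (inj₁ refl)
strict-or-defeasible? defeasible = yes (inj₂ refl)
strict-or-defeasible? defeater = no λ { (inj₁ ()) ; (inj₂ ()) }

module FiniteEncoding {Atom : Set} (D : Theory Atom) (rules : List (Theory.Rule D))
                      (∈-rules : ∀ r → r ∈ rules) (q : Lit Atom) where
  open Theory D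

  R : ℕ
  R = length rules

  rule : Fin R → Rule
  rule = lookup rules

  ∀-rule : (P : Rule → Set) → (∀ i → P (rule i)) → ∀ r → P r
  ∀-rule P f r = subst P (sym (lookup-index (∈-rules r))) (f _)

  ∃-rule : (P : Rule → Set) → Σ Rule P → Σ (Fin R) (P ∘ rule)
  ∃-rule P (r , p) = _ , subst P (lookup-index (∈-rules r)) p

  Occurrence : Set
  Occurrence = Σ (Fin R) λ i → Fin (length (ante (rule i)))

  occurrences : List Occurrence
  occurrences = concatMap (λ i → map (i ,_) (allFin _)) (allFin R)

  ∈-occurrences : ∀ o → o ∈ occurrences
  ∈-occurrences (i , j) = ∈-concatMap⁺ _ (lose (∈-allFin i) (∈-map⁺ (i ,_) (∈-allFin j)))

  -- A code names q (nothing) or the j-th antecedent of rule i (just (i , j)); the flag true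
  -- stands for the complement of that literal.
  Code : Set
  Code = Bool × Maybe Occurrence

  base : Maybe Occurrence → Lit Atom
  base nothing = q
  base (just (i , j)) = lookup (ante (rule i)) j

  literal : Code → Lit Atom
  literal (false , o) = base o
  literal (true , o) = ∼ base o

  target : Code
  target = false , nothing

  complement : Code → Code
  complement (b , o) = not b , o

  literal-complement : ∀ κ → literal (complement κ) ≡ ∼ literal κ
  literal-complement (false , o) = refl
  literal-complement (true , o) = sym (∼-involutive (base o))

  codes : List Code
  codes = cartesianProduct (false ∷ true ∷ []) (nothing ∷ map just occurrences)

  ∈-codes : ∀ κ → κ ∈ codes
  ∈-codes (b , nothing) = ∈-cartesianProduct⁺ (∈-bools b) (here refl)
  ∈-codes (b , just o) =
    ∈-cartesianProduct⁺ (∈-bools b) (there (∈-map⁺ just (∈-occurrences o)))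

  _≟ᵏ_ : DecidableEquality Code
  _≟ᵏ_ = Product.≡-dec _≟ᵇ_ (Maybe.≡-dec (Product.≡-dec _≟ᶠ_ _≟ᶠ_))

  Position Guard : Set
  Position = Component × Code
  Guard = Fin R × Code

  Holds : Guard → Set
  Holds (i , κ) = InR D (rule i) (literal κ)

  open GuardedFormulas Position Guard Holds

  allAnte anyAnte : Component → Fin R → Formula
  allAnte c i = ⋀ λ j → var (c , false , just (i , j))
  anyAnte c i = ⋁ λ j → var (c , false , just (i , j))

  system : Position → Formula
  system (+Δᶜ , κ) =
    const (Fact (literal κ)) ∨ ⋁ λ i → const (InRs D (rule i) (literal κ)) ∧ allAnte +Δᶜ i
  system (-Δᶜ , κ) =
    var (-Δᶜ , κ) ∨ ⋀ (λ i → strict? (kind (rule i)) ⇒? (i , κ) ⇒ anyAnte -Δᶜ i)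
                  ∧ const (¬ Fact (literal κ))
  system (+∂ᶜ , κ) =
    var (+Δᶜ , κ) ∨ ⋁ (λ i → const (InRsd D (rule i) (literal κ)) ∧ allAnte +∂ᶜ i)
                  ∧ var (-Δᶜ , complement κ)
                  ∧ ⋀ λ s → (s , complement κ) ⇒ anyAnte -∂ᶜ s ∨ ⋁ λ t →
                        const (InRsd D (rule t) (literal κ)) ∧ allAnte +∂ᶜ t ∧ const (rule t ≻ rule s)
  system (-∂ᶜ , κ) =
    var (-Δᶜ , κ) ∧ (⋀ (λ i → strict-or-defeasible? (kind (rule i)) ⇒? (i , κ) ⇒ anyAnte -∂ᶜ i)
                    ∨ var (+Δᶜ , complement κ)
                    ∨ ⋁ λ s → const (InR D (rule s) (∼ literal κ)) ∧ allAnte +∂ᶜ s ∧ ⋀ λ t →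
                        strict-or-defeasible? (kind (rule t)) ⇒? (t , κ) ⇒
                          anyAnte -∂ᶜ t ∨ const (¬ rule t ≻ rule s))

  ⟪_⟫ : Ext Atom → Position → Set
  ⟪ Y ⟫ (c , κ) = component c Y (literal κ)

  system-complete : ∀ Y p → ⟪ T D Y ⟫ p → ⟦ system p ⟧ ⟪ Y ⟫
  system-complete Y (+Δᶜ , κ) (inj₁ f) = inj₁ f
  system-complete Y (+Δᶜ , κ) (inj₂ r) =
    let i , h , as = ∃-rule _ r in inj₂ (i , h , All⇒lookup as)
  system-complete Y (-Δᶜ , κ) (inj₁ x) = inj₁ x
  system-complete Y (-Δᶜ , κ) (inj₂ (f , nf)) =
    inj₂ ((λ i s h → Any⇒lookup (f (rule i) (s , h))) , nf)
  system-complete Y (+∂ᶜ , κ) (inj₁ x) = inj₁ x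
  system-complete Y (+∂ᶜ , κ) (inj₂ (r , x , f)) =
    let i , h , as = ∃-rule _ r in
    inj₂ ((i , h , All⇒lookup as) , subst (-Δ Y) (sym (literal-complement κ)) x , λ s h′ →
      case f (rule s) (trans h′ (literal-complement κ)) of λ where
        (inj₁ xs) → inj₁ (Any⇒lookup xs)
        (inj₂ t) → let j , ht , as′ , t≻s = ∃-rule _ t in inj₂ (j , ht , All⇒lookup as′ , t≻s))
  system-complete Y (-∂ᶜ , κ) (x , inj₁ f) =
    x , inj₁ λ i s h → Any⇒lookup (f (rule i) (s , h))
  system-complete Y (-∂ᶜ , κ) (x , inj₂ (inj₁ y)) =
    x , inj₂ (inj₁ (subst (+Δ Y) (sym (literal-complement κ)) y))
  system-complete Y (-∂ᶜ , κ) (x , inj₂ (inj₂ s)) =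
    let i , h , as , f = ∃-rule _ s in
    x , inj₂ (inj₂ (i , h , All⇒lookup as , λ t sd h′ →
      Sum.map₁ Any⇒lookup (f (rule t) (sd , h′))))

  system-sound : ∀ Y p → ⟦ system p ⟧ ⟪ Y ⟫ → ⟪ T D Y ⟫ p
  system-sound Y (+Δᶜ , κ) (inj₁ f) = inj₁ f
  system-sound Y (+Δᶜ , κ) (inj₂ (i , h , as)) = inj₂ (rule i , h , lookup⇒All as)
  system-sound Y (-Δᶜ , κ) (inj₁ x) = inj₁ x
  system-sound Y (-Δᶜ , κ) (inj₂ (f , nf)) =
    inj₂ (∀-rule _ (λ i (s , h) → lookup⇒Any (f i s h)) , nf)
  system-sound Y (+∂ᶜ , κ) (inj₁ x) = inj₁ x
  system-sound Y (+∂ᶜ , κ) (inj₂ ((i , h , as) , x , f)) =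
    inj₂ ((rule i , h , lookup⇒All as) , subst (-Δ Y) (literal-complement κ) x , ∀-rule _ λ s h′ →
      Sum.map lookup⇒Any (λ (t , ht , as′ , t≻s) → rule t , ht , lookup⇒All as′ , t≻s)
              (f s (trans h′ (sym (literal-complement κ)))))
  system-sound Y (-∂ᶜ , κ) (x , inj₁ f) =
    x , inj₁ (∀-rule _ λ i (s , h) → lookup⇒Any (f i s h))
  system-sound Y (-∂ᶜ , κ) (x , inj₂ (inj₁ y)) =
    x , inj₂ (inj₁ (subst (+Δ Y) (literal-complement κ) y))
  system-sound Y (-∂ᶜ , κ) (x , inj₂ (inj₂ (s , h , as , f))) =
    x , inj₂ (inj₂ (rule s , h , lookup⇒All as , ∀-rule _ λ t (sd , h′) →
      Sum.map₁ lookup⇒Any (f t sd h′)))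

  open Stabilisation (Product.≡-dec _≟ᶜ_ _≟ᵏ_) (cartesianProduct components codes)
                     (λ (c , κ) → ∈-cartesianProduct⁺ (∈-components c) (∈-codes κ))
                     (Product.≡-dec _≟ᶠ_ _≟ᵏ_) (cartesianProduct (allFin R) codes)
                     (λ (i , κ) → ∈-cartesianProduct⁺ (∈-allFin i) (∈-codes κ))
                     Holds system

  iterate⇒Kleene : ∀ n p → iterate system n p → ⟪ T D ↑ n ⟫ p
  iterate⇒Kleene (suc n) p x = system-sound (T D ↑ n) p (⟦⟧-mono (system p) (iterate⇒Kleene n) x)

  Kleene⇒iterate : ∀ n p → ⟪ T D ↑ n ⟫ p → iterate system n p
  Kleene⇒iterate zero (c , κ) x = ⊥-elim (⊥ext-empty c x)
  Kleene⇒iterate (suc n) p x = ⟦⟧-mono (system p) (Kleene⇒iterate n) (system-complete (T D ↑ n) p x)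

  limit-bounded : ∀ p → ⟪ limit D ⟫ p → ⟪ T D ↑ N ⟫ p
  limit-bounded (c , κ) x =
    let n , y = limit-stage D c x in
    iterate⇒Kleene N (c , κ) (stabilises n (c , κ) (Kleene⇒iterate n (c , κ) y))

  T-limit⊆limit : ∀ c → component c (T D (limit D)) q → component c (limit D) q
  T-limit⊆limit c x = ⊑-elim (Kleene⊑limit D (suc N)) c q
    (system-sound (T D ↑ N) (c , target) (⟦⟧-mono (system (c , target)) limit-bounded
      (system-complete (limit D) (c , target) x)))

module _ {Atom : Set} (D : Theory Atom) where

  -- The facts need not be finite: they enter T_D only as side conditions.
  T-limit⊑limit : Finite D → T D (limit D) ⊑ limit D
  T-limit⊑limit ((rules , ∈-rules) , _) =
    ⊑-intro λ c q → FiniteEncoding.T-limit⊆limit D rules ∈-rules q c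

  limit-least-fixpoint : Finite D → ∀ L → IsLeastFixpoint D L → limit D ≐ L
  limit-least-fixpoint fin L ((TL⊑L , _) , L-least) =
    limit-least D L (Kleene⊑prefixpoint D TL⊑L) , L-least (limit D) (T-limit⊑limit fin , limit⊑T-limit D)

proposition2p2 : {Atom : Set} (D : Theory Atom) →
    (∀ X Y → X ⊑ Y → T D X ⊑ T D Y)
    × (∀ n → (T D ↑ n) ⊑ (T D ↑ suc n))
    × ((∀ n → (T D ↑ n) ⊑ limit D)
       × (∀ Y → (∀ n → (T D ↑ n) ⊑ Y) → limit D ⊑ Y))
    × Σ (Ext Atom) (λ L → IsLeastFixpoint D L)
    × (Finite D → ∀ L → IsLeastFixpoint D L → limit D ≐ L)
proposition2p2 D =
  T-mono D , Kleene-increasing D , (Kleene⊑limit D , limit-least D) , (μT-ext D , μT-least-fixpoint D) ,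
  limit-least-fixpoint D
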